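{- Let $V_1,\dots,V_p$ be pairwise disjoint finite sets, $\mathcal{H}_i\subseteq 2^{V_i}$ transversal-free hypergraphs, and $\mathcal{H}=\mathcal{H}_1\boxplus\dots\boxplus\mathcal{H}_p$ on $V=V_1\cup\dots\cup V_p$. Then for every position $\mathbf{x}\in\mathbb{Z}_+^V$ and every move $\mathbf{x}\to\mathbf{x}'$ of Nim$_\mathcal{H}$, $\mathcal{U}(M(\mathbf{x}),Y(\mathbf{x}),h(\mathbf{x}))\neq\mathcal{U}(M(\mathbf{x}'),Y(\mathbf{x}'),h(\mathbf{x}'))$.
   Context: A hypergraph on a finite set $W$ is a family of nonempty subsets of $W$ (edges) covering $W$. An edge is transversal if it meets every edge; transversal-free means no transversal edge. In Nim$_\mathcal{F}$ a move $\mathbf{x}\to\mathbf{x}'$ on $\mathbb{Z}_+^W$ chooses an edge $F$ and has $x'_i<x_i$ for $i\in F$, $x'_i=x_i$ otherwise. Height $h_\mathcal{F}(\mathbf{x})$: maximum number of consecutive moves from $\mathbf{x}$; $m(\mathbf{x})=\min_ix_i$; $y_\mathcal{F}(\mathbf{x})=h_\mathcal{F}(\mathbf{x}-m(\mathbf{x})\mathbf{e})$. Selective compound: $\mathcal{H}_1\boxplus\dots\boxplus\mathcal{H}_p=\{\bigcup_iH^i\mid H^i\in\mathcal{H}_i\cup\{\emptyset\}\}\setminus\{\emptyset\}$. For $\mathbf{x}=(\mathbf{x}^1,\dots,\mathbf{x}^p)$: $M(\mathbf{x})=\sum_im(\mathbf{x}^i)$, $Y(\mathbf{x})=\sum_iy_{\mathcal{H}_i}(\mathbf{x}^i)$,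 $h(\mathbf{x})=\sum_ih_{\mathcal{H}_i}(\mathbf{x}^i)$. $v(m,y)=\binom{y+1}{2}+((m-\binom{y+1}{2}-1)\bmod(y+1))$; $\mathcal{U}(m,y,h)=h$ if $m\leq\binom{y+1}{2}$ and $v(m,y)$ otherwise. -}

module Defs where

open import Data.Nat using (ℕ; zero; suc; _+_; _∸_; _<_; _≤ᵇ_; _⊓_)
open import Data.Nat.DivMod using (_%_)
open import Data.Nat.Combinatorics using (_C_)
open import Data.Fin using (Fin; zero; suc)
open import Data.Fin.Subset using (Subset; _∈_; _∉_; _∩_; Nonempty)
open import Data.List using (List)
import Data.List.Membership.Propositional as L
open import Data.Maybe using (Maybe; just; nothing)
open import Data.Bool using (if_then_else_)
open import Data.Product using (Σ; ∃; _×_; _,_)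
open import Relation.Binary.PropositionalEquality using (_≡_)
open import Relation.Nullary using (¬_)

record Hypergraph (n : ℕ) : Set where
  field
    edges    : List (Subset n)
    nonempty : ∀ E → E L.∈ edges → Nonempty E
    covering : ∀ (j : Fin n) → ∃ λ E → E L.∈ edges × j ∈ E
open Hypergraph public

Transversal : ∀ {n} → Hypergraph n → Subset n → Set
Transversal H E = ∀ E′ → E′ L.∈ edges H → Nonempty (E ∩ E′)

TransversalFree : ∀ {n} → Hypergraph n → Set
TransversalFree H = ¬ (∃ λ E → E L.∈ edges H × Transversal H E)

Pos : ℕ → Set
Pos n = Fin n → ℕ

MoveAlong : ∀ {n} → Subset n → Pos n → Pos n → Set
MoveAlong E x x′ = (∀ j → j ∈ E → x′ j < x j) × (∀ j → j ∉ E → x′ j ≡ x j)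

Move : ∀ {n} → Hypergraph n → Pos n → Pos n → Set
Move H x x′ = ∃ λ E → E L.∈ edges H × MoveAlong E x x′

data Chain {n} (H : Hypergraph n) : Pos n → ℕ → Set where
  stop : ∀ {x} → Chain H x 0
  step : ∀ {x x′ k} → Move H x x′ → Chain H x′ k → Chain H x (suc k)

IsHeight : ∀ {n} → Hypergraph n → Pos n → ℕ → Set
IsHeight H x h = Chain H x h × (∀ k → Chain H x k → k Data.Nat.≤ h)

-- m(x) = min_i x_i  (convention: 0 for the empty ground set)
minP : ∀ {n} → Pos n → ℕ
minP {zero} x = 0
minP {suc zero} x = x zero
minP {suc (suc n)} x = x zero ⊓ minP (λ j → x (suc j))

shift : ∀ {n} → Pos n → Pos n
shift x j = x j ∸ minP x

IsY : ∀ {n} → Hypergraph n → Pos n → ℕ → Set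
IsY H x y = IsHeight H (shift x) y

-- Selective compound of H_1, …, H_p on the disjoint union V of the
-- V_i = Fin (ns i).  Positions on V are families x = (x^1, …, x^p).

CPos : ∀ {p} → (Fin p → ℕ) → Set
CPos {p} ns = (i : Fin p) → Pos (ns i)

-- An edge of H_1 ⊞ … ⊞ H_p is ⋃_i H^i with H^i ∈ H_i ∪ {∅}, not empty.
-- We record the choice of H^i (nothing = ∅).  The union is nonempty
-- iff some H^i is chosen (edges of H_i are nonempty).
Choice : ∀ {p} {ns : Fin p → ℕ} → ((i : Fin p) → Hypergraph (ns i)) → Set
Choice {p} {ns} Hs =
  Σ ((i : Fin p) → Maybe (Subset (ns i))) λ c →
    (∀ i E → c i ≡ just E → E L.∈ edges (Hs i)) × (∃ λ i → ∃ λ E → c i ≡ just E)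

InUnion : ∀ {p} {ns : Fin p → ℕ} → ((i : Fin p) → Maybe (Subset (ns i))) →
          (i : Fin p) → Fin (ns i) → Set
InUnion c i j = ∃ λ E → c i ≡ just E × j ∈ E

CompoundMove : ∀ {p} {ns : Fin p → ℕ} → ((i : Fin p) → Hypergraph (ns i)) →
               CPos ns → CPos ns → Set
CompoundMove Hs x x′ = Σ (Choice Hs) λ { (c , _) →
  (∀ i j → InUnion c i j → x′ i j < x i j) ×
  (∀ i j → ¬ InUnion c i j → x′ i j ≡ x i j) }

sumF : ∀ {p} → (Fin p → ℕ) → ℕ
sumF {zero} f = 0
sumF {suc p} f = f zero + sumF (λ i → f (suc i))

Mc : ∀ {p} {ns : Fin p → ℕ} → CPos ns → ℕ
Mc x = sumF (λ i → minP (x i))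

tri : ℕ → ℕ
tri y = suc y C 2

v : ℕ → ℕ → ℕ
v m y = tri y + ((m ∸ tri y ∸ 1) % suc y)

𝒰 : ℕ → ℕ → ℕ → ℕ
𝒰 m y h = if m ≤ᵇ tri y then h else v m y

-- Per component, a move never raises m, lowers h where it acts, and h ≥ y + m
-- (the y moves from x − m(x)e, lifted by m(x), followed by m(x) moves along any
-- edge).  Transversal-freeness bounds the drop of m: the chosen edge E misses
-- some edge E′, on which x′ = x ≥ m(x), so E′ can be played m(x) − m(x′) times
-- from x′ − m(x′)e; thus m(x) − m(x′) ≤ y(x′).  If m is unchanged in every
-- component, the move survives subtracting m(x)e, so y drops.  Summing,
-- M = M′ + D with D ≤ Y′, Y′ + M′ ≤ h′ < h, and D = 0 forces Y′ < Y.  As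
-- tri Y ≤ v(M,Y) < min(M, tri (Y+1)), the values of 𝒰 differ unless both
-- positions are above the threshold with Y = Y′; then 0 < D ≤ Y, and v reads M
-- modulo Y+1.
module Submission where

open import Defs
open import Data.Nat using (ℕ; zero; suc; _+_; _∸_; _≤_; _<_; _≤ᵇ_; z≤n; s≤s; z<s; pred; NonZero)
open import Data.Nat.Properties
open import Data.Nat.DivMod using (_%_; m%n<n; m%n≤m; m<n⇒m%n≡m; %-distribˡ-+; m≤n⇒[n∸m]%m≡n%m)
open import Data.Nat.Combinatorics using (nC1≡n; nCk+nC[k+1]≡[n+1]C[k+1])
open import Data.Fin using (Fin; zero; suc)
open import Data.Fin.Subset using (Subset; _∈_; _∉_; _∩_; Nonempty)
open import Data.Fin.Subset.Properties using (_∈?_; nonempty?; x∈p∩q⁺)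
import Data.List.Membership.Propositional as L
open import Data.List.Relation.Unary.All using (all?; lookup)
open import Data.List.Relation.Unary.All.Properties using (¬All⇒Any¬)
open import Data.Maybe using (just; nothing)
open import Data.Maybe.Properties using (just-injective)
open import Data.Bool using (true; false; T)
open import Data.Unit using (tt)
open import Data.Empty using (⊥-elim)
open import Data.Product using (∃; _×_; _,_; proj₁)
open import Data.Sum using (_⊎_; inj₁; inj₂)
open import Relation.Binary.PropositionalEquality
open import Function using (_∘_)
open import Algebra.Properties.CommutativeSemigroup +-commutativeSemigroup
  using () renaming (interchange to +-interchange)
open import Relation.Binary.Definitions using (tri<; tri≈; tri>)
open import Relation.Nullary using (¬_; yes; no)

minP-≤ : ∀ {n} (x : Pos n) j → minP x ≤ x j
minP-≤ {suc zero}    x zero    = ≤-refl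
minP-≤ {suc (suc n)} x zero    = m⊓n≤m (x zero) _
minP-≤ {suc (suc n)} x (suc j) = ≤-trans (m⊓n≤n (x zero) _) (minP-≤ (λ k → x (suc k)) j)

minP-mono-≤ : ∀ {n} {x y : Pos n} → (∀ j → x j ≤ y j) → minP x ≤ minP y
minP-mono-≤ {zero}        le = z≤n
minP-mono-≤ {suc zero}    le = le zero
minP-mono-≤ {suc (suc n)} le = ⊓-mono-≤ (le zero) (minP-mono-≤ (λ k → le (suc k)))

minP-cong : ∀ {n} {x y : Pos n} → x ≗ y → minP x ≡ minP y
minP-cong eq = ≤-antisym (minP-mono-≤ (≤-reflexive ∘ eq)) (minP-mono-≤ (≤-reflexive ∘ sym ∘ eq))

MoveOrStay : ∀ {n} → Hypergraph n → Pos n → Pos n → Set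
MoveOrStay H x x′ = Move H x x′ ⊎ x′ ≗ x

moveAlong-≤ : ∀ {n} {E : Subset n} {x x′ : Pos n} → MoveAlong E x x′ → ∀ j → x′ j ≤ x j
moveAlong-≤ {E = E} (lt , eq) j with j ∈? E
... | yes j∈ = <⇒≤ (lt j j∈)
... | no  j∉ = ≤-reflexive (eq j j∉)

module _ {n} (H : Hypergraph n) where

  chain-cong : ∀ {x y k} → x ≗ y → Chain H x k → Chain H y k
  chain-cong eq stop = stop
  chain-cong eq (step (E , E∈ , lt , same) c) =
    step (E , E∈ , (λ j j∈ → subst (_ <_) (eq j) (lt j j∈)) , (λ j j∉ → trans (same j j∉) (eq j))) c

  lower : Subset n → Pos n → Pos n
  lower E x j with j ∈? E
  ... | yes _ = pred (x j)
  ... | no  _ = x j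

  edge-chain : ∀ {E} → E L.∈ edges H → ∀ c {x} → (∀ j → j ∈ E → c ≤ x j) → Chain H x c
  edge-chain E∈ zero    c≤ = stop
  edge-chain {E} E∈ (suc c) {x} c≤ =
    step (E , E∈ , lower-< , lower-∉) (edge-chain E∈ c lower-≥)
    where
    lower-< : ∀ j → j ∈ E → lower E x j < x j
    lower-< j j∈ with j ∈? E
    ... | yes _ = ∸-monoʳ-< z<s (≤-trans (s≤s z≤n) (c≤ j j∈))
    ... | no j∉ = ⊥-elim (j∉ j∈)
    lower-∉ : ∀ j → j ∉ E → lower E x j ≡ x j
    lower-∉ j j∉ with j ∈? E
    ... | yes j∈ = ⊥-elim (j∉ j∈)
    ... | no  _  = refl
    lower-≥ : ∀ j → j ∈ E → c ≤ lower E x j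
    lower-≥ j j∈ with j ∈? E
    ... | yes _ = pred-mono-≤ (c≤ j j∈)
    ... | no j∉ = ⊥-elim (j∉ j∈)

  chain-lift : ∀ {x k} c → (∀ {z} → (∀ j → c ≤ z j) → Chain H z c) →
               Chain H x k → Chain H (λ j → x j + c) (k + c)
  chain-lift c tail stop = tail (λ j → m≤n+m c _)
  chain-lift c tail (step (E , E∈ , lt , same) ch) =
    step (E , E∈ , (λ j j∈ → +-monoˡ-< c (lt j j∈)) , (λ j j∉ → cong (_+ c) (same j j∉)))
         (chain-lift c tail ch)

minP-chain : ∀ {n} (H : Hypergraph n) (x z : Pos n) → (∀ j → minP x ≤ z j) → Chain H z (minP x)
minP-chain {zero}  H x z le = stop
minP-chain {suc n} H x z le with covering H zero
... | E , E∈ , _ = edge-chain H E∈ (minP x) (λ j _ → le j)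

module _ {n} (H : Hypergraph n) where

  y+m≤h : ∀ {x h y} → IsHeight H x h → IsY H x y → y + minP x ≤ h
  y+m≤h {x} (_ , maximal) (chain-y , _) =
    maximal _ (chain-cong H (λ j → m∸n+n≡m (minP-≤ x j))
                          (chain-lift H (minP x) (minP-chain H x _) chain-y))

  height-< : ∀ {x x′ h h′} → Move H x x′ → IsHeight H x h → IsHeight H x′ h′ → h′ < h
  height-< mv (_ , maximal) (chain′ , _) = maximal _ (step mv chain′)

  height-≤ : ∀ {x x′ h h′} → MoveOrStay H x x′ → IsHeight H x h → IsHeight H x′ h′ → h′ ≤ h
  height-≤ (inj₁ mv) hx hx′ = <⇒≤ (height-< mv hx hx′)
  height-≤ (inj₂ eq) (_ , maximal) (chain′ , _) = maximal _ (chain-cong H eq chain′)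

  minP-step-≤ : ∀ {x x′} → MoveOrStay H x x′ → minP x′ ≤ minP x
  minP-step-≤ (inj₁ (_ , _ , mv)) = minP-mono-≤ (moveAlong-≤ mv)
  minP-step-≤ (inj₂ eq)           = ≤-reflexive (minP-cong eq)

  shift-move : ∀ {x x′} → Move H x x′ → minP x′ ≡ minP x → Move H (shift x) (shift x′)
  shift-move {x} {x′} (E , E∈ , lt , same) m≡ =
    E , E∈ ,
    (λ j j∈ → subst (λ m → x′ j ∸ minP x′ < x j ∸ m) m≡ (∸-monoˡ-< (lt j j∈) (minP-≤ x′ j))) ,
    (λ j j∉ → cong₂ _∸_ (same j j∉) m≡)

  shift-step : ∀ {x x′} → MoveOrStay H x x′ → minP x′ ≡ minP x → MoveOrStay H (shift x) (shift x′)
  shift-step (inj₁ mv) m≡ = inj₁ (shift-move mv m≡)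
  shift-step (inj₂ eq) m≡ = inj₂ (λ j → cong₂ _∸_ (eq j) m≡)

  non-transversal-edge : ∀ {E} → ¬ Transversal H E →
                         ∃ λ E′ → E′ L.∈ edges H × ¬ Nonempty (E ∩ E′)
  non-transversal-edge {E} ¬T with all? (λ E′ → nonempty? (E ∩ E′)) (edges H)
  ... | yes all = ⊥-elim (¬T (λ E′ → lookup all))
  ... | no ¬all = L.find (¬All⇒Any¬ (λ E′ → nonempty? (E ∩ E′)) (edges H) ¬all)

  minP-drop-≤ : TransversalFree H → ∀ {x x′ y′} → MoveOrStay H x x′ → IsY H x′ y′ →
                minP x ∸ minP x′ ≤ y′
  minP-drop-≤ TF {x} {x′} (inj₁ (E , E∈ , _ , same)) (_ , maximal)
    with non-transversal-edge (λ T → TF (E , E∈ , T))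
  ... | E′ , E′∈ , disjoint = maximal _ (edge-chain H E′∈ _ drop≤shift)
    where
    drop≤shift : ∀ j → j ∈ E′ → minP x ∸ minP x′ ≤ shift x′ j
    drop≤shift j j∈′ with j ∈? E
    ... | yes j∈ = ⊥-elim (disjoint (j , x∈p∩q⁺ (j∈ , j∈′)))
    ... | no  j∉ = ∸-monoˡ-≤ (minP x′) (subst (minP x ≤_) (sym (same j j∉)) (minP-≤ x j))
  minP-drop-≤ TF {y′ = y′} (inj₂ eq) _ =
    subst (_≤ y′) (sym (m≤n⇒m∸n≡0 (≤-reflexive (sym (minP-cong eq))))) z≤n

sumF-cong : ∀ {p} {f g : Fin p → ℕ} → f ≗ g → sumF f ≡ sumF g
sumF-cong {zero}  eq = refl
sumF-cong {suc p} eq = cong₂ _+_ (eq zero) (sumF-cong (eq ∘ suc))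

sumF-+ : ∀ {p} (f g : Fin p → ℕ) → sumF (λ i → f i + g i) ≡ sumF f + sumF g
sumF-+ {zero}  f g = refl
sumF-+ {suc p} f g =
  trans (cong (f zero + g zero +_) (sumF-+ (f ∘ suc) (g ∘ suc)))
        (+-interchange (f zero) (g zero) (sumF (f ∘ suc)) (sumF (g ∘ suc)))

sumF-mono-≤ : ∀ {p} {f g : Fin p → ℕ} → (∀ i → f i ≤ g i) → sumF f ≤ sumF g
sumF-mono-≤ {zero}  le = z≤n
sumF-mono-≤ {suc p} le = +-mono-≤ (le zero) (sumF-mono-≤ (le ∘ suc))

sumF-mono-< : ∀ {p} {f g : Fin p → ℕ} → (∀ i → f i ≤ g i) → ∀ i → f i < g i → sumF f < sumF g
sumF-mono-< {suc p} le zero    lt = +-mono-<-≤ lt (sumF-mono-≤ (le ∘ suc))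
sumF-mono-< {suc p} le (suc i) lt = +-mono-≤-< (le zero) (sumF-mono-< (le ∘ suc) i lt)

sumF≡0⇒≡0 : ∀ {p} (f : Fin p → ℕ) → sumF f ≡ 0 → ∀ i → f i ≡ 0
sumF≡0⇒≡0 {suc p} f eq zero    = m+n≡0⇒m≡0 (f zero) eq
sumF≡0⇒≡0 {suc p} f eq (suc i) = sumF≡0⇒≡0 (f ∘ suc) (m+n≡0⇒n≡0 (f zero) eq) i

tri-suc : ∀ y → tri (suc y) ≡ suc y + tri y
tri-suc y = trans (sym (nCk+nC[k+1]≡[n+1]C[k+1] (suc y) 1)) (cong (_+ tri y) (nC1≡n (suc y)))

tri-mono-≤ : ∀ {y y′} → y ≤ y′ → tri y ≤ tri y′
tri-mono-≤ z≤n = z≤n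
tri-mono-≤ {suc y} {suc y′} y≤y′@(s≤s le) = begin
  tri (suc y)     ≡⟨ tri-suc y ⟩
  suc y + tri y   ≤⟨ +-mono-≤ y≤y′ (tri-mono-≤ le) ⟩
  suc y′ + tri y′ ≡⟨ tri-suc y′ ⟨
  tri (suc y′)    ∎
  where open ≤-Reasoning

tri≤v : ∀ m y → tri y ≤ v m y
tri≤v m y = m≤m+n (tri y) _

v<tri : ∀ m y → v m y < tri (suc y)
v<tri m y = begin-strict
  tri y + (m ∸ tri y ∸ 1) % suc y <⟨ +-monoʳ-< (tri y) (m%n<n (m ∸ tri y ∸ 1) (suc y)) ⟩
  tri y + suc y                   ≡⟨ +-comm (tri y) (suc y) ⟩
  suc y + tri y                   ≡⟨ tri-suc y ⟨
  tri (suc y)                     ∎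
  where open ≤-Reasoning

v<m : ∀ m y → tri y < m → v m y < m
v<m m y lt = begin-strict
  tri y + (m ∸ tri y ∸ 1) % suc y ≤⟨ +-monoʳ-≤ (tri y) (m%n≤m (m ∸ tri y ∸ 1) (suc y)) ⟩
  tri y + (m ∸ tri y ∸ 1)         <⟨ +-monoʳ-< (tri y) (∸-monoʳ-< z<s (m<n⇒0<n∸m lt)) ⟩
  tri y + (m ∸ tri y)             ≡⟨ m+[n∸m]≡n (<⇒≤ lt) ⟩
  m                               ∎
  where open ≤-Reasoning

[r+d]%n≢r : ∀ {r d n} .{{_ : NonZero n}} → r < n → 0 < d → d < n → (r + d) % n ≢ r
[r+d]%n≢r {r} {d} {n} r<n 0<d d<n with ≤-<-connex n (r + d)
... | inj₂ r+d<n = >⇒≢ (subst (r <_) (sym (m<n⇒m%n≡m r+d<n)) (m<m+n r 0<d))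
... | inj₁ n≤r+d = <⇒≢ (begin-strict
  (r + d) % n     ≡⟨ m≤n⇒[n∸m]%m≡n%m n≤r+d ⟨
  (r + d ∸ n) % n ≤⟨ m%n≤m (r + d ∸ n) n ⟩
  r + d ∸ n       <⟨ ∸-monoˡ-< (+-monoʳ-< r d<n) n≤r+d ⟩
  r + n ∸ n       ≡⟨ m+n∸n≡m r n ⟩
  r               ∎)
  where open ≤-Reasoning

%-+-≢ : ∀ a {d n} .{{_ : NonZero n}} → 0 < d → d < n → (a + d) % n ≢ a % n
%-+-≢ a {d} {n} 0<d d<n eq = [r+d]%n≢r (m%n<n a n) 0<d d<n (begin
  (a % n + d) % n     ≡⟨ cong (λ e → (a % n + e) % n) (m<n⇒m%n≡m d<n) ⟨
  (a % n + d % n) % n ≡⟨ %-distribˡ-+ a d n ⟨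
  (a + d) % n         ≡⟨ eq ⟩
  a % n               ∎)
  where open ≡-Reasoning

v-+-≢ : ∀ {m d y} → tri y < m → 0 < d → d ≤ y → v (m + d) y ≢ v m y
v-+-≢ {m} {d} {y} lt 0<d d≤y eq = %-+-≢ (m ∸ tri y ∸ 1) 0<d (s≤s d≤y) (begin
  (m ∸ tri y ∸ 1 + d) % suc y ≡⟨ cong (_% suc y) (sym +d∸) ⟩
  (m + d ∸ tri y ∸ 1) % suc y ≡⟨ +-cancelˡ-≡ (tri y) _ _ eq ⟩
  (m ∸ tri y ∸ 1) % suc y     ∎)
  where
  open ≡-Reasoning
  +d∸ : m + d ∸ tri y ∸ 1 ≡ m ∸ tri y ∸ 1 + d
  +d∸ = trans (cong (_∸ 1) (+-∸-comm d (<⇒≤ lt))) (+-∸-comm d (m<n⇒0<n∸m lt))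

v-≢ : ∀ {m′ d y y′} → tri y′ < m′ → d ≤ y′ → (d ≡ 0 → y′ < y) → v (m′ + d) y ≢ v m′ y′
v-≢ {m′} {d} {y} {y′} lt d≤y′ d≡0⇒y′<y with <-cmp y y′
... | tri< y<y′ _ _ = <⇒≢ (<-≤-trans (v<tri _ y) (≤-trans (tri-mono-≤ y<y′) (tri≤v m′ y′)))
... | tri> _ _ y′<y = >⇒≢ (<-≤-trans (v<tri m′ y′) (≤-trans (tri-mono-≤ y′<y) (tri≤v _ y)))
... | tri≈ _ refl _ with d
...   | zero  = ⊥-elim (<-irrefl refl (d≡0⇒y′<y refl))
...   | suc _ = v-+-≢ lt z<s d≤y′

𝒰-cases : ∀ m y h → (m ≤ tri y × 𝒰 m y h ≡ h) ⊎ (tri y < m × 𝒰 m y h ≡ v m y)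
𝒰-cases m y h with m ≤ᵇ tri y in e
... | true  = inj₁ (≤ᵇ⇒≤ m (tri y) (subst T (sym e) tt) , refl)
... | false = inj₂ (≰⇒> (λ le → subst T e (≤⇒≤ᵇ le)) , refl)

𝒰-≢ : ∀ {m′ d y y′ h h′} → d ≤ y′ → (d ≡ 0 → y′ < y) → y′ + m′ ≤ h′ → h′ < h →
      𝒰 (m′ + d) y h ≢ 𝒰 m′ y′ h′
𝒰-≢ {m′} {d} {y} {y′} {h} {h′} d≤y′ d≡0⇒y′<y y′+m′≤h′ h′<h eq
  with 𝒰-cases (m′ + d) y h | 𝒰-cases m′ y′ h′
... | inj₁ (_ , e) | inj₁ (_ , e′) = >⇒≢ h′<h (trans (sym e) (trans eq e′))
... | inj₁ (_ , e) | inj₂ (above′ , e′) = >⇒≢ h>v (trans (sym e) (trans eq e′))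
  where
  h>v : v m′ y′ < h
  h>v = begin-strict
    v m′ y′ <⟨ v<m m′ y′ above′ ⟩
    m′      ≤⟨ m≤n+m m′ y′ ⟩
    y′ + m′ ≤⟨ y′+m′≤h′ ⟩
    h′      <⟨ h′<h ⟩
    h       ∎
    where open ≤-Reasoning
... | inj₂ (above , e) | inj₁ (_ , e′) = <⇒≢ v<h′ (trans (sym e) (trans eq e′))
  where
  v<h′ : v (m′ + d) y < h′
  v<h′ = begin-strict
    v (m′ + d) y <⟨ v<m (m′ + d) y above ⟩
    m′ + d       ≤⟨ +-monoʳ-≤ m′ d≤y′ ⟩
    m′ + y′      ≡⟨ +-comm m′ y′ ⟩
    y′ + m′      ≤⟨ y′+m′≤h′ ⟩
    h′           ∎
    where open ≤-Reasoning
... | inj₂ (_ , e) | inj₂ (above′ , e′) = v-≢ above′ d≤y′ d≡0⇒y′<y (trans (sym e) (trans eq e′))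

module _ {p} {ns : Fin p → ℕ} (Hs : (i : Fin p) → Hypergraph (ns i)) {x x′ : CPos ns} where

  chosen-move : (mv : CompoundMove Hs x x′) → ∀ {i E} → proj₁ (proj₁ mv) i ≡ just E →
                Move (Hs i) (x i) (x′ i)
  chosen-move ((_ , chosen∈ , _) , lt , same) {i} {E} e =
    E , chosen∈ i E e , (λ j j∈ → lt i j (E , e , j∈)) ,
    (λ j j∉ → same i j λ { (E′ , e′ , j∈′) →
                j∉ (subst (j ∈_) (just-injective (trans (sym e′) e)) j∈′) })

  compound-step : CompoundMove Hs x x′ → ∀ i → MoveOrStay (Hs i) (x i) (x′ i)
  compound-step mv@((c , _) , _ , same) i with c i in e
  ... | just E  = inj₁ (chosen-move mv e)
  ... | nothing = inj₂ λ j → same i j λ { (_ , e′ , _) → nothing≢just (trans (sym e) e′) }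
    where
    nothing≢just : ∀ {A : Set} {a : A} → nothing ≢ just a
    nothing≢just ()

  compound-move : CompoundMove Hs x x′ → ∃ λ i → Move (Hs i) (x i) (x′ i)
  compound-move mv@((_ , _ , i , _ , e) , _) = i , chosen-move mv e

Y+M≤h : ∀ {p} {ns : Fin p → ℕ} (Hs : (i : Fin p) → Hypergraph (ns i)) {x : CPos ns}
        {h y : Fin p → ℕ} → (∀ i → IsHeight (Hs i) (x i) (h i)) → (∀ i → IsY (Hs i) (x i) (y i)) →
        sumF y + Mc x ≤ sumF h
Y+M≤h Hs {x} {h} {y} isH isY =
  subst (_≤ sumF h) (sumF-+ y (λ i → minP (x i)))
        (sumF-mono-≤ (λ i → y+m≤h (Hs i) (isH i) (isY i)))

lemma6 : (p : ℕ) (ns : Fin p → ℕ) (Hs : (i : Fin p) → Hypergraph (ns i)) →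
         (∀ i → TransversalFree (Hs i)) →
         (x x′ : CPos ns) → CompoundMove Hs x x′ →
         (hx hx′ yx yx′ : Fin p → ℕ) →
         (∀ i → IsHeight (Hs i) (x i) (hx i)) →
         (∀ i → IsHeight (Hs i) (x′ i) (hx′ i)) →
         (∀ i → IsY (Hs i) (x i) (yx i)) →
         (∀ i → IsY (Hs i) (x′ i) (yx′ i)) →
         𝒰 (Mc x) (sumF yx) (sumF hx) ≢ 𝒰 (Mc x′) (sumF yx′) (sumF hx′)
lemma6 p ns Hs TF x x′ mv hx hx′ yx yx′ isH isH′ isY isY′ with compound-move Hs mv
... | i₀ , move₀ =
  subst (λ M → 𝒰 M (sumF yx) (sumF hx) ≢ 𝒰 (Mc x′) (sumF yx′) (sumF hx′)) (sym M≡M′+D)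
        (𝒰-≢ D≤Y′ D≡0⇒Y′<Y (Y+M≤h Hs isH′ isY′) h′<h)
  where
  steps : ∀ i → MoveOrStay (Hs i) (x i) (x′ i)
  steps = compound-step Hs mv

  drop : Fin p → ℕ
  drop i = minP (x i) ∸ minP (x′ i)

  M≡M′+D : Mc x ≡ Mc x′ + sumF drop
  M≡M′+D = trans (sumF-cong (λ i → sym (m+[n∸m]≡n (minP-step-≤ (Hs i) (steps i)))))
                 (sumF-+ (λ i → minP (x′ i)) drop)

  D≤Y′ : sumF drop ≤ sumF yx′
  D≤Y′ = sumF-mono-≤ (λ i → minP-drop-≤ (Hs i) (TF i) (steps i) (isY′ i))

  h′<h : sumF hx′ < sumF hx
  h′<h = sumF-mono-< (λ i → height-≤ (Hs i) (steps i) (isH i) (isH′ i)) i₀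
                     (height-< (Hs i₀) move₀ (isH i₀) (isH′ i₀))

  D≡0⇒Y′<Y : sumF drop ≡ 0 → sumF yx′ < sumF yx
  D≡0⇒Y′<Y D≡0 =
    sumF-mono-< (λ i → height-≤ (Hs i) (shift-step (Hs i) (steps i) (m′≡m i)) (isY i) (isY′ i)) i₀
                (height-< (Hs i₀) (shift-move (Hs i₀) move₀ (m′≡m i₀)) (isY i₀) (isY′ i₀))
    where
    m′≡m : ∀ i → minP (x′ i) ≡ minP (x i)
    m′≡m i = ≤-antisym (minP-step-≤ (Hs i) (steps i)) (m∸n≡0⇒m≤n (sumF≡0⇒≡0 drop D≡0 i))
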